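{- Let $n,t$ be positive integers. If there exists a collection of $t$ mutually orthogonal Latin squares of order $n$, then $\tau_t(K_n^2)=tn$.
   Context: A Latin square of order $n$ is an $n\times n$ array with entries in $[n]$ in which each element of $[n]$ appears exactly once in each row and each column. Two Latin squares $A=(a_{ij})$, $B=(b_{ij})$ are orthogonal if the pairs $(a_{ij},b_{ij})$ for $(i,j)\in[n]^2$ are pairwise distinct; a collection is mutually orthogonal if every pair is orthogonal. $K_n^2$ is the Cartesian product $K_n\times K_n$: vertex set $[n]^2$, two vertices adjacent iff they differ in exactly one coordinate. For an integer $t\ge1$, a $t$-tone coloring of a graph $G$ assigns to each vertex $v$ a set $f(v)$ of exactly $t$ colors from a color set $C$ such that $|f(u)\cap f(v)|<d(u,v)$ for all distinct $u,v$, where $d$ is graph distance; $\tau_t(G)$ is the minimum $|C|$ over all such colorings. -}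

module Defs where

open import Data.Nat using (ℕ; zero; suc; _<_; _*_)
open import Data.Fin using (Fin)
open import Data.Fin.Subset using (Subset; _∩_; ∣_∣)
open import Data.Product using (_×_; _,_; ∃)
open import Data.Sum using (_⊎_)
open import Relation.Binary.PropositionalEquality using (_≡_; _≢_)
open import Relation.Nullary using (¬_)
open import Level using (0ℓ)

Array : ℕ → Set
Array n = Fin n → Fin n → Fin n

IsLatinSquare : (n : ℕ) → Array n → Set
IsLatinSquare n L =
  (∀ i k → ∃ λ j → L i j ≡ k × (∀ j′ → L i j′ ≡ k → j′ ≡ j)) ×
  (∀ j k → ∃ λ i → L i j ≡ k × (∀ i′ → L i′ j ≡ k → i′ ≡ i))

Orthogonal : (n : ℕ) → Array n → Array n → Set
Orthogonal n A B =
  ∀ i j i′ j′ → (i , j) ≢ (i′ , j′) → (A i j , B i j) ≢ (A i′ j′ , B i′ j′)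

MOLS : (t n : ℕ) → Set
MOLS t n = ∃ λ (L : Fin t → Array n) →
  (∀ r → IsLatinSquare n (L r)) ×
  (∀ r s → r ≢ s → Orthogonal n (L r) (L s))

record Graph : Set₁ where
  field
    V   : Set
    Adj : V → V → Set

data Walk (G : Graph) : Graph.V G → Graph.V G → ℕ → Set where
  here : ∀ {u} → Walk G u u zero
  step : ∀ {u w v k} → Graph.Adj G u w → Walk G w v k → Walk G u v (suc k)

-- m < d(u,v), where d is graph distance (the least length of a walk;
-- ∞ if none): equivalently every walk from u to v has length > m.
_<dist[_]_,_ : ℕ → (G : Graph) → Graph.V G → Graph.V G → Set
m <dist[ G ] u , v = ∀ k → Walk G u v k → m < k

K²[_] : ℕ → Graph
K²[ n ] = record
  { V   = Fin n × Fin n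
  ; Adj = λ { (a , b) (c , d) → (a ≡ c × b ≢ d) ⊎ (a ≢ c × b ≡ d) }
  }

IsTToneColoring : (G : Graph) (t c : ℕ) → (Graph.V G → Subset c) → Set
IsTToneColoring G t c f =
  (∀ v → ∣ f v ∣ ≡ t) ×
  (∀ u v → u ≢ v → ∣ f u ∩ f v ∣ <dist[ G ] u , v)

HasTToneColoring : (G : Graph) (t c : ℕ) → Set
HasTToneColoring G t c = ∃ λ (f : Graph.V G → Subset c) → IsTToneColoring G t c f

τ[_]_≡_ : ℕ → Graph → ℕ → Set
τ[ t ] G ≡ m = HasTToneColoring G t m × (∀ c → c < m → ¬ HasTToneColoring G t c)

-- Upper bound: give the cell (i , j) the colours (r , L_r i j) for the t squares L_r, with
-- colour set [t] × [n]. Cells in a common row or column differ in every square, so their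
-- colour sets are disjoint; two distinct cells agree in at most one square, since two
-- agreeing squares would repeat a pair and violate orthogonality, so any two colour sets
-- share at most one colour. Lower bound: the n cells of a row are pairwise adjacent, so
-- they carry n pairwise disjoint t-sets of colours.
module Submission where

open import Defs
open import Data.Nat using (ℕ; zero; suc; _+_; _*_; _≤_; z≤n; s≤s; NonZero)
open import Data.Nat.Properties
  using (≤-trans; ≤-reflexive; +-suc; +-identityʳ; *-comm; m≤n+m; n≤0⇒n≡0; n<1⇒n≡0; <⇒≱
        ; module ≤-Reasoning)
open import Data.Bool using (true; false)
open import Data.Fin using (Fin; zero; suc)
open import Data.Fin.Properties using (_≟_; suc-injective; 0≢1+n)
open import Data.Fin.Subset using (Subset; _∩_; _∪_; ∣_∣; ⁅_⁆; ⊥; ⋃)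
open import Data.Fin.Subset.Properties
  using (∣⊥∣≡0; ∣⁅x⁆∣≡1; ∣p∣≤n; ∣p∩q∣≤∣p∣; ∩-zeroˡ; ∩-zeroʳ; ∩-distribˡ-∪)
open import Data.List using (List; []; _∷_; length; tabulate)
open import Data.List.Properties using (length-tabulate)
open import Data.List.Relation.Unary.All using (All; []; _∷_)
import Data.List.Relation.Unary.All.Properties as All
open import Data.List.Relation.Unary.AllPairs using (AllPairs; []; _∷_)
import Data.List.Relation.Unary.AllPairs.Properties as AllPairs
open import Data.Vec using ([]; _∷_; _++_)
open import Data.Vec.Properties using (zipWith-++)
open import Data.Product using (_×_; _,_; proj₁; proj₂)
open import Data.Sum using (inj₁; inj₂)
open import Function using (_∘_)
open import Relation.Nullary using (yes; no; contradiction)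
open import Relation.Binary.PropositionalEquality

private
  variable
    c m n t : ℕ

∣p++q∣≡∣p∣+∣q∣ : (p : Subset m) (q : Subset n) → ∣ p ++ q ∣ ≡ ∣ p ∣ + ∣ q ∣
∣p++q∣≡∣p∣+∣q∣ []          q = refl
∣p++q∣≡∣p∣+∣q∣ (true ∷ p)  q = cong suc (∣p++q∣≡∣p∣+∣q∣ p q)
∣p++q∣≡∣p∣+∣q∣ (false ∷ p) q = ∣p++q∣≡∣p∣+∣q∣ p q

∣[p++q]∩[p′++q′]∣ : (p p′ : Subset m) (q q′ : Subset n) →
                    ∣ (p ++ q) ∩ (p′ ++ q′) ∣ ≡ ∣ p ∩ p′ ∣ + ∣ q ∩ q′ ∣
∣[p++q]∩[p′++q′]∣ p p′ q q′ = begin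
  ∣ (p ++ q) ∩ (p′ ++ q′) ∣       ≡⟨ cong ∣_∣ (zipWith-++ _ p q p′ q′) ⟩
  ∣ (p ∩ p′) ++ (q ∩ q′) ∣        ≡⟨ ∣p++q∣≡∣p∣+∣q∣ (p ∩ p′) (q ∩ q′) ⟩
  ∣ p ∩ p′ ∣ + ∣ q ∩ q′ ∣         ∎
  where open ≡-Reasoning

∣p∩q∣+∣p∪q∣≡∣p∣+∣q∣ : (p q : Subset n) → ∣ p ∩ q ∣ + ∣ p ∪ q ∣ ≡ ∣ p ∣ + ∣ q ∣
∣p∩q∣+∣p∪q∣≡∣p∣+∣q∣ []          []          = refl
∣p∩q∣+∣p∪q∣≡∣p∣+∣q∣ (true ∷ p)  (true ∷ q)  = cong suc (begin
  ∣ p ∩ q ∣ + suc ∣ p ∪ q ∣     ≡⟨ +-suc _ _ ⟩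
  suc (∣ p ∩ q ∣ + ∣ p ∪ q ∣)   ≡⟨ cong suc (∣p∩q∣+∣p∪q∣≡∣p∣+∣q∣ p q) ⟩
  suc (∣ p ∣ + ∣ q ∣)           ≡⟨ +-suc _ _ ⟨
  ∣ p ∣ + suc ∣ q ∣             ∎)
  where open ≡-Reasoning
∣p∩q∣+∣p∪q∣≡∣p∣+∣q∣ (true ∷ p)  (false ∷ q) =
  trans (+-suc _ _) (cong suc (∣p∩q∣+∣p∪q∣≡∣p∣+∣q∣ p q))
∣p∩q∣+∣p∪q∣≡∣p∣+∣q∣ (false ∷ p) (true ∷ q)  =
  trans (+-suc _ _) (trans (cong suc (∣p∩q∣+∣p∪q∣≡∣p∣+∣q∣ p q)) (sym (+-suc _ _)))
∣p∩q∣+∣p∪q∣≡∣p∣+∣q∣ (false ∷ p) (false ∷ q) = ∣p∩q∣+∣p∪q∣≡∣p∣+∣q∣ p q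

Disjoint : Subset n → Subset n → Set
Disjoint p q = ∣ p ∩ q ∣ ≡ 0

Disjoint-⊥ : (p : Subset n) → Disjoint p ⊥
Disjoint-⊥ {n} p = trans (cong ∣_∣ (∩-zeroʳ p)) (∣⊥∣≡0 n)

Disjoint-∪ : (p q r : Subset n) → Disjoint p q → Disjoint p r → Disjoint p (q ∪ r)
Disjoint-∪ p q r p#q p#r = n≤0⇒n≡0 (begin
  ∣ p ∩ (q ∪ r) ∣                       ≡⟨ cong ∣_∣ (∩-distribˡ-∪ p q r) ⟩
  ∣ (p ∩ q) ∪ (p ∩ r) ∣                 ≤⟨ m≤n+m _ ∣ (p ∩ q) ∩ (p ∩ r) ∣ ⟩
  ∣ (p ∩ q) ∩ (p ∩ r) ∣ + ∣ (p ∩ q) ∪ (p ∩ r) ∣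
                                        ≡⟨ ∣p∩q∣+∣p∪q∣≡∣p∣+∣q∣ (p ∩ q) (p ∩ r) ⟩
  ∣ p ∩ q ∣ + ∣ p ∩ r ∣                 ≡⟨ cong₂ _+_ p#q p#r ⟩
  0                                     ∎)
  where open ≤-Reasoning

Disjoint-⋃ : (p : Subset n) {qs : List (Subset n)} → All (Disjoint p) qs → Disjoint p (⋃ qs)
Disjoint-⋃ p []                        = Disjoint-⊥ p
Disjoint-⋃ p {q ∷ qs} (p#q ∷ p#qs) = Disjoint-∪ p q (⋃ qs) p#q (Disjoint-⋃ p p#qs)

∣p∪q∣≡∣p∣+∣q∣ : (p q : Subset n) → Disjoint p q → ∣ p ∪ q ∣ ≡ ∣ p ∣ + ∣ q ∣
∣p∪q∣≡∣p∣+∣q∣ p q p#q =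
  trans (cong (_+ ∣ p ∪ q ∣) (sym p#q)) (∣p∩q∣+∣p∪q∣≡∣p∣+∣q∣ p q)

∣⋃ps∣≡length*t : {ps : List (Subset n)} → AllPairs Disjoint ps → All (λ p → ∣ p ∣ ≡ t) ps →
                 ∣ ⋃ ps ∣ ≡ length ps * t
∣⋃ps∣≡length*t {n} []                 []            = ∣⊥∣≡0 n
∣⋃ps∣≡length*t {ps = p ∷ ps} (p#ps ∷ disj) (∣p∣≡t ∷ sizes) = begin
  ∣ p ∪ ⋃ ps ∣          ≡⟨ ∣p∪q∣≡∣p∣+∣q∣ p (⋃ ps) (Disjoint-⋃ p p#ps) ⟩
  ∣ p ∣ + ∣ ⋃ ps ∣      ≡⟨ cong₂ _+_ ∣p∣≡t (∣⋃ps∣≡length*t disj sizes) ⟩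
  _ + length ps * _     ∎
  where open ≡-Reasoning

disjointFamily⇒m*t≤n : (F : Fin m → Subset n) → (∀ i → ∣ F i ∣ ≡ t) →
                       (∀ {i j} → i ≢ j → Disjoint (F i) (F j)) → m * t ≤ n
disjointFamily⇒m*t≤n {m} {n} {t} F sizes disj = begin
  m * t                        ≡⟨ cong (_* t) (length-tabulate F) ⟨
  length (tabulate F) * t      ≡⟨ ∣⋃ps∣≡length*t (AllPairs.tabulate⁺ disj) (All.tabulate⁺ sizes) ⟨
  ∣ ⋃ (tabulate F) ∣           ≤⟨ ∣p∣≤n (⋃ (tabulate F)) ⟩
  n                            ∎
  where open ≤-Reasoning

⁅x⁆-Disjoint-⁅y⁆ : {x y : Fin n} → x ≢ y → Disjoint ⁅ x ⁆ ⁅ y ⁆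
⁅x⁆-Disjoint-⁅y⁆ {n} {zero}  {zero}  x≢y = contradiction refl x≢y
⁅x⁆-Disjoint-⁅y⁆ {n} {zero}  {suc y} x≢y = trans (cong ∣_∣ (∩-zeroˡ ⁅ y ⁆)) (∣⊥∣≡0 n)
⁅x⁆-Disjoint-⁅y⁆ {n} {suc x} {zero}  x≢y = Disjoint-⊥ ⁅ x ⁆
⁅x⁆-Disjoint-⁅y⁆ {n} {suc x} {suc y} x≢y = ⁅x⁆-Disjoint-⁅y⁆ (x≢y ∘ cong suc)

-- The graph {(r , g r)} of g, as a subset of [t] × [n] enumerated row by row.
graphSubset : (Fin t → Fin n) → Subset (t * n)
graphSubset {zero}  g = []
graphSubset {suc t} g = ⁅ g zero ⁆ ++ graphSubset (g ∘ suc)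

∣graphSubset∣ : (g : Fin t → Fin n) → ∣ graphSubset g ∣ ≡ t
∣graphSubset∣ {zero}  g = refl
∣graphSubset∣ {suc t} g =
  trans (∣p++q∣≡∣p∣+∣q∣ ⁅ g zero ⁆ _) (cong₂ _+_ (∣⁅x⁆∣≡1 (g zero)) (∣graphSubset∣ (g ∘ suc)))

graphSubset-Disjoint : (g h : Fin t → Fin n) → (∀ r → g r ≢ h r) →
                       Disjoint (graphSubset g) (graphSubset h)
graphSubset-Disjoint {zero}  g h g≢h = refl
graphSubset-Disjoint {suc t} g h g≢h = begin
  ∣ graphSubset g ∩ graphSubset h ∣
    ≡⟨ ∣[p++q]∩[p′++q′]∣ ⁅ g zero ⁆ ⁅ h zero ⁆ _ _ ⟩
  ∣ ⁅ g zero ⁆ ∩ ⁅ h zero ⁆ ∣ + ∣ graphSubset (g ∘ suc) ∩ graphSubset (h ∘ suc) ∣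
    ≡⟨ cong₂ _+_ (⁅x⁆-Disjoint-⁅y⁆ (g≢h zero)) (graphSubset-Disjoint (g ∘ suc) (h ∘ suc) (g≢h ∘ suc)) ⟩
  0 ∎
  where open ≡-Reasoning

∣graphSubset∩graphSubset∣≤1 : (g h : Fin t → Fin n) →
                              (∀ {r s} → g r ≡ h r → g s ≡ h s → r ≡ s) →
                              ∣ graphSubset g ∩ graphSubset h ∣ ≤ 1
∣graphSubset∩graphSubset∣≤1 {zero}  g h agreeOnce = z≤n
∣graphSubset∩graphSubset∣≤1 {suc t} g h agreeOnce
  rewrite ∣[p++q]∩[p′++q′]∣ ⁅ g zero ⁆ ⁅ h zero ⁆ (graphSubset (g ∘ suc)) (graphSubset (h ∘ suc))
  with g zero ≟ h zero
... | yes g₀≡h₀ = begin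
  ∣ ⁅ g zero ⁆ ∩ ⁅ h zero ⁆ ∣ + ∣ graphSubset (g ∘ suc) ∩ graphSubset (h ∘ suc) ∣
    ≡⟨ cong (∣ ⁅ g zero ⁆ ∩ ⁅ h zero ⁆ ∣ +_) (graphSubset-Disjoint (g ∘ suc) (h ∘ suc) onlyAtZero) ⟩
  ∣ ⁅ g zero ⁆ ∩ ⁅ h zero ⁆ ∣ + 0    ≡⟨ +-identityʳ _ ⟩
  ∣ ⁅ g zero ⁆ ∩ ⁅ h zero ⁆ ∣        ≤⟨ ∣p∩q∣≤∣p∣ ⁅ g zero ⁆ ⁅ h zero ⁆ ⟩
  ∣ ⁅ g zero ⁆ ∣                    ≡⟨ ∣⁅x⁆∣≡1 (g zero) ⟩
  1                                 ∎
  where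
  open ≤-Reasoning
  onlyAtZero : ∀ r → g (suc r) ≢ h (suc r)
  onlyAtZero r gᵣ≡hᵣ = 0≢1+n (agreeOnce g₀≡h₀ gᵣ≡hᵣ)
... | no g₀≢h₀ rewrite ⁅x⁆-Disjoint-⁅y⁆ g₀≢h₀ =
  ∣graphSubset∩graphSubset∣≤1 (g ∘ suc) (h ∘ suc) (λ e e′ → suc-injective (agreeOnce e e′))

<dist-intro : {G : Graph} {u v : Graph.V G} {m : ℕ} → u ≢ v →
              (Graph.Adj G u v → m ≡ 0) → m ≤ 1 → m <dist[ G ] u , v
<dist-intro u≢v adj⇒m≡0 m≤1 _ here                  = contradiction refl u≢v
<dist-intro u≢v adj⇒m≡0 m≤1 _ (step adj here)       = s≤s (≤-reflexive (adj⇒m≡0 adj))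
<dist-intro u≢v adj⇒m≡0 m≤1 _ (step _ (step _ _))   = s≤s (≤-trans m≤1 (s≤s z≤n))

adjacent⇒Disjoint : {G : Graph} (f : Graph.V G → Subset c) → IsTToneColoring G t c f →
                    {u v : Graph.V G} → u ≢ v → Graph.Adj G u v → Disjoint (f u) (f v)
adjacent⇒Disjoint f (_ , separated) {u} {v} u≢v adj =
  n<1⇒n≡0 (separated u v u≢v 1 (step adj here))

IsClique : (G : Graph) → (Fin m → Graph.V G) → Set
IsClique G v = ∀ {i j} → i ≢ j → v i ≢ v j × Graph.Adj G (v i) (v j)

clique⇒m*t≤c : {G : Graph} {v : Fin m → Graph.V G} → IsClique G v →
               HasTToneColoring G t c → m * t ≤ c
clique⇒m*t≤c {v = v} clique (f , tone) = disjointFamily⇒m*t≤n (f ∘ v)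
  (λ i → proj₁ tone (v i))
  (λ i≢j → adjacent⇒Disjoint f tone (proj₁ (clique i≢j)) (proj₂ (clique i≢j)))

row-isClique : (i : Fin n) → IsClique K²[ n ] (i ,_)
row-isClique i j≢k = j≢k ∘ cong proj₂ , inj₁ (refl , j≢k)

tToneColoring-K²⇒t*n≤c : .{{NonZero n}} → HasTToneColoring K²[ n ] t c → t * n ≤ c
tToneColoring-K²⇒t*n≤c {suc n} {t} colouring =
  ≤-trans (≤-reflexive (*-comm t (suc n))) (clique⇒m*t≤c (row-isClique zero) colouring)

Cell : ℕ → Set
Cell n = Fin n × Fin n

entry : Array n → Cell n → Fin n
entry L (i , j) = L i j

adjacent⇒entry≢ : {L : Array n} → IsLatinSquare n L →
                  {u v : Cell n} → Graph.Adj K²[ n ] u v → entry L u ≢ entry L v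
adjacent⇒entry≢ {L = L} (rows , _) {i , j} (inj₁ (refl , j≢j′)) Lᵤ≡Lᵥ
  with rows i (L i j)
... | _ , _ , unique = j≢j′ (trans (unique j refl) (sym (unique _ (sym Lᵤ≡Lᵥ))))
adjacent⇒entry≢ {L = L} (_ , columns) {i , j} (inj₂ (i≢i′ , refl)) Lᵤ≡Lᵥ
  with columns j (L i j)
... | _ , _ , unique = i≢i′ (trans (unique i refl) (sym (unique _ (sym Lᵤ≡Lᵥ))))

orthogonal⇒¬agreeTwice : {A B : Array n} → Orthogonal n A B → {u v : Cell n} → u ≢ v →
                         entry A u ≡ entry A v → entry B u ≢ entry B v
orthogonal⇒¬agreeTwice orth {i , j} {i′ , j′} u≢v Aᵤ≡Aᵥ Bᵤ≡Bᵥ =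
  orth i j i′ j′ u≢v (cong₂ _,_ Aᵤ≡Aᵥ Bᵤ≡Bᵥ)

module _ (M : MOLS t n) where

  private
    L = proj₁ M
    latin = proj₁ (proj₂ M)
    orthogonal = proj₂ (proj₂ M)

  molsColouring : Cell n → Subset (t * n)
  molsColouring u = graphSubset (λ r → entry (L r) u)

  molsColouring-isTTone : IsTToneColoring K²[ n ] t (t * n) molsColouring
  molsColouring-isTTone = (λ u → ∣graphSubset∣ _) , λ u v u≢v →
    <dist-intro u≢v
      (λ adj → graphSubset-Disjoint _ _ (λ r → adjacent⇒entry≢ (latin r) adj))
      (∣graphSubset∩graphSubset∣≤1 _ _ (agreeAtMostOnce u≢v))
    where
    agreeAtMostOnce : {u v : Cell n} → u ≢ v → {r s : Fin t} →
                      entry (L r) u ≡ entry (L r) v → entry (L s) u ≡ entry (L s) v → r ≡ s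
    agreeAtMostOnce u≢v {r} {s} agreeᵣ agreeₛ with r ≟ s
    ... | yes r≡s = r≡s
    ... | no  r≢s = contradiction agreeₛ (orthogonal⇒¬agreeTwice (orthogonal r s r≢s) u≢v agreeᵣ)

theorem1p16 : (n t : ℕ) → .{{NonZero n}} → .{{NonZero t}} →
    MOLS t n → τ[ t ] K²[ n ] ≡ (t * n)
theorem1p16 n t M =
  (molsColouring M , molsColouring-isTTone M) ,
  λ c c<t*n colouring → <⇒≱ c<t*n (tToneColoring-K²⇒t*n≤c colouring)
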